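{- Let $A$ be an $n\times n$ real positive semidefinite matrix whose rows and columns are indexed by $[n]=\{1,\dots,n\}$, and let $A^\dagger$ denote its Moore--Penrose inverse. For $S\subseteq [n]$, if $A[S,S]$ is nonsingular, then $A^\dagger[S,S]$ is also nonsingular.
   Context: For an $n\times n$ matrix $B$ and $S,K\subseteq[n]$, $B[S,K]$ denotes the submatrix of $B$ formed by the rows indexed by $S$ and the columns indexed by $K$. The Moore--Penrose inverse $A^\dagger$ of $A$ is the unique matrix $G$ with $AGA=A$, $GAG=G$, $(AG)'=AG$, $(GA)'=GA$, where $'$ denotes transpose. -}

module Defs where

open import Level using (0ℓ)
open import Data.Nat using (ℕ; zero; suc)
open import Data.Fin using (Fin; zero; suc; toℕ)
import Data.Nat as ℕ
open import Data.Product using (Σ; ∃; _×_; _,_)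
open import Data.Sum using (_⊎_)
open import Relation.Nullary using (¬_)
open import Relation.Binary.PropositionalEquality using (_≡_)

import Algebra.Structures as AS

-- The real numbers, given axiomatically: a complete ordered field
-- (any model is isomorphic to ℝ).  Equality is propositional equality.

record RealField : Set₁ where
  infixl 6 _+_
  infixl 7 _*_
  infix  4 _≤_
  field
    Carrier : Set
    _+_ _*_ : Carrier → Carrier → Carrier
    -_      : Carrier → Carrier
    0# 1#   : Carrier
    isCommutativeRing : AS.IsCommutativeRing {A = Carrier} _≡_ _+_ _*_ -_ 0# 1#
    0≢1     : ¬ (0# ≡ 1#)
    inverse : ∀ x → ¬ (x ≡ 0#) → Σ Carrier (λ y → x * y ≡ 1#)
    _≤_     : Carrier → Carrier → Set
    ≤-refl  : ∀ x → x ≤ x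
    ≤-trans : ∀ {x y z} → x ≤ y → y ≤ z → x ≤ z
    ≤-antisym : ∀ {x y} → x ≤ y → y ≤ x → x ≡ y
    ≤-total : ∀ x y → x ≤ y ⊎ y ≤ x
    +-mono-≤ : ∀ {x y} z → x ≤ y → x + z ≤ y + z
    *-nonneg : ∀ {x y} → 0# ≤ x → 0# ≤ y → 0# ≤ x * y
    lub : (P : Carrier → Set) → Σ Carrier P →
          Σ Carrier (λ b → ∀ x → P x → x ≤ b) →
          Σ Carrier (λ s → (∀ x → P x → x ≤ s) ×
                           (∀ b → (∀ x → P x → x ≤ b) → s ≤ b))

module Matrices (R : RealField) where
  open RealField R

  Matrix : ℕ → ℕ → Set
  Matrix m k = Fin m → Fin k → Carrier

  sumF : ∀ n → (Fin n → Carrier) → Carrier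
  sumF zero    f = 0#
  sumF (suc n) f = f zero + sumF n (λ i → f (suc i))

  _⊗_ : ∀ {m k l} → Matrix m k → Matrix k l → Matrix m l
  _⊗_ {k = k} A B i j = sumF k (λ t → A i t * B t j)

  _ᵀ : ∀ {m k} → Matrix m k → Matrix k m
  (A ᵀ) i j = A j i

  I : ∀ n → Matrix n n
  I n i j with i Data.Fin.≟ j
  ... | Relation.Nullary.yes _ = 1#
  ... | Relation.Nullary.no  _ = 0#

  _≐_ : ∀ {m k} → Matrix m k → Matrix m k → Set
  A ≐ B = ∀ i j → A i j ≡ B i j

  Nonsingular : ∀ {n} → Matrix n n → Set
  Nonsingular {n} A = Σ (Matrix n n) (λ B → ((A ⊗ B) ≐ I n) × ((B ⊗ A) ≐ I n))

  PSD : ∀ {n} → Matrix n n → Set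
  PSD {n} A = ((A ᵀ) ≐ A) ×
    (∀ (x : Fin n → Carrier) →
       0# ≤ sumF n (λ i → sumF n (λ j → x i * (A i j * x j))))

  IsMoorePenrose : ∀ {n} → Matrix n n → Matrix n n → Set
  IsMoorePenrose A G =
    (((A ⊗ G) ⊗ A) ≐ A) × (((G ⊗ A) ⊗ G) ≐ G) ×
    (((A ⊗ G) ᵀ) ≐ (A ⊗ G)) × (((G ⊗ A) ᵀ) ≐ (G ⊗ A))

  -- a subset S ⊆ [n] with |S| = k, listed in increasing order
  StrictlyIncreasing : ∀ {k n} → (Fin k → Fin n) → Set
  StrictlyIncreasing σ = ∀ i j → toℕ i ℕ.< toℕ j → toℕ (σ i) ℕ.< toℕ (σ j)

  sub : ∀ {n k} → Matrix n n → (Fin k → Fin n) → Matrix k k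
  sub B σ i j = B (σ i) (σ j)

-- A† is symmetric and A† = A†AA†, so y'A†y = (A†y)'A(A†y); and for positive semidefinite A,
-- w'Aw = 0 forces Aw = 0. So if x'A†[S,S]x = 0, extend x by zero to y and put w = A†y:
-- then Aw = 0, hence Ay = A(AA†)y = A(Aw) = 0, whose rows in S say A[S,S]x = 0, so x = 0.
-- Thus A†[S,S] is symmetric and anisotropic, and such a matrix is invertible: its first
-- diagonal entry is a nonzero pivot whose Schur complement is again symmetric and anisotropic.
module Submission where

open import Defs
open import Level using (0ℓ)
open import Algebra.Bundles using (CommutativeRing)
import Algebra.Solver.Ring
import Algebra.Solver.Ring.AlmostCommutativeRing as ACR
open import Data.Empty using (⊥-elim)
open import Data.Fin using (Fin; zero; suc; _≟_)
open import Data.Integer.Base as ℤ using (ℤ; -[1+_]; 0ℤ; 1ℤ)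
import Data.Integer.Properties as ℤₚ
open import Data.Maybe.Base as Maybe using (Maybe)
open import Data.Nat.Base as ℕ using (ℕ; zero; suc)
import Data.Nat.Properties as ℕₚ
open import Data.Sign.Base as Sign using (Sign)
open import Function.Base using (_∘_)
open import Relation.Binary.Bundles using (Setoid)
import Relation.Binary.PropositionalEquality as ≡
import Relation.Binary.Reasoning.Setoid
open import Relation.Nullary.Decidable.Core using (dec⇒maybe; yes; no)
open import Relation.Nullary.Negation.Core using (¬_)

-- The normal forms of Algebra.Solver.Ring are compared by refl, so the coefficient
-- arithmetic has to compute: we use ℤ, mapped into an arbitrary commutative ring.
module IntegerCoefficientRingSolver {c ℓ} (R : CommutativeRing c ℓ) where
  open CommutativeRing R
  open import Algebra.Properties.Ring ring using (-0#≈0#; -‿+-comm; -‿involutive; -1*x≈-x)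
  open import Algebra.Properties.Semiring.Mult.TCOptimised semiring
    using (_×_; 1+×; ×-homo-+; ×1-homo-*)
  open import Algebra.Properties.CommutativeSemigroup +-commutativeSemigroup
    renaming (interchange to +-interchange)
  open import Algebra.Properties.CommutativeSemigroup *-commutativeSemigroup
    renaming (interchange to *-interchange)
  open import Relation.Binary.Reasoning.Setoid setoid

  -- This _×_ satisfies 1 × x = x definitionally, so con 1ℤ denotes 1# itself.
  ⟦_⟧ : ℤ → Carrier
  ⟦ ℤ.+ n ⟧    = n × 1#
  ⟦ -[1+ n ] ⟧ = - (suc n × 1#)

  ⊖-homo : ∀ m n → ⟦ m ℤ.⊖ n ⟧ ≈ m × 1# - n × 1#
  ⊖-homo m       0       = sym (trans (+-congˡ -0#≈0#) (+-identityʳ _))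
  ⊖-homo 0       (suc n) = sym (+-identityˡ _)
  ⊖-homo (suc m) (suc n) = begin
    ⟦ suc m ℤ.⊖ suc n ⟧               ≡⟨ ≡.cong ⟦_⟧ (ℤₚ.[1+m]⊖[1+n]≡m⊖n m n) ⟩
    ⟦ m ℤ.⊖ n ⟧                       ≈⟨ ⊖-homo m n ⟩
    m × 1# - n × 1#                   ≈⟨ +-identityˡ _ ⟨
    0# + (m × 1# - n × 1#)            ≈⟨ +-congʳ (-‿inverseʳ 1#) ⟨
    (1# - 1#) + (m × 1# - n × 1#)     ≈⟨ +-interchange _ _ _ _ ⟩
    (1# + m × 1#) + (- 1# - n × 1#)   ≈⟨ +-congˡ (-‿+-comm 1# (n × 1#)) ⟩
    (1# + m × 1#) - (1# + n × 1#)     ≈⟨ +-cong (1+× m 1#) (-‿cong (1+× n 1#)) ⟨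
    suc m × 1# - suc n × 1#           ∎

  +-homo : ∀ i j → ⟦ i ℤ.+ j ⟧ ≈ ⟦ i ⟧ + ⟦ j ⟧
  +-homo (ℤ.+ m)  (ℤ.+ n)  = ×-homo-+ 1# m n
  +-homo (ℤ.+ m)  -[1+ n ] = ⊖-homo m (suc n)
  +-homo -[1+ m ] (ℤ.+ n)  = trans (⊖-homo n (suc m)) (+-comm _ _)
  +-homo -[1+ m ] -[1+ n ] = begin
    - (suc (suc (m ℕ.+ n)) × 1#)      ≡⟨ ≡.cong (λ k → - (suc k × 1#)) (ℕₚ.+-suc m n) ⟨
    - ((suc m ℕ.+ suc n) × 1#)        ≈⟨ -‿cong (×-homo-+ 1# (suc m) (suc n)) ⟩
    - (suc m × 1# + suc n × 1#)       ≈⟨ -‿+-comm _ _ ⟨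
    - (suc m × 1#) + - (suc n × 1#)   ∎

  sign⟦_⟧ : Sign → Carrier
  sign⟦ Sign.+ ⟧ = 1#
  sign⟦ Sign.- ⟧ = - 1#

  sign-homo : ∀ s t → sign⟦ s Sign.* t ⟧ ≈ sign⟦ s ⟧ * sign⟦ t ⟧
  sign-homo Sign.+ t      = sym (*-identityˡ _)
  sign-homo Sign.- Sign.+ = sym (*-identityʳ _)
  sign-homo Sign.- Sign.- = sym (trans (-1*x≈-x (- 1#)) (-‿involutive 1#))

  ◃-homo : ∀ s n → ⟦ s ℤ.◃ n ⟧ ≈ sign⟦ s ⟧ * (n × 1#)
  ◃-homo s      0       = sym (zeroʳ _)
  ◃-homo Sign.+ (suc n) = sym (*-identityˡ _)
  ◃-homo Sign.- (suc n) = sym (-1*x≈-x _)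

  *-homo : ∀ i j → ⟦ i ℤ.* j ⟧ ≈ ⟦ i ⟧ * ⟦ j ⟧
  *-homo i j = begin
    ⟦ i ℤ.* j ⟧
      ≈⟨ ◃-homo (ℤ.sign i Sign.* ℤ.sign j) (ℤ.∣ i ∣ ℕ.* ℤ.∣ j ∣) ⟩
    sign⟦ ℤ.sign i Sign.* ℤ.sign j ⟧ * ((ℤ.∣ i ∣ ℕ.* ℤ.∣ j ∣) × 1#)
      ≈⟨ *-cong (sign-homo (ℤ.sign i) (ℤ.sign j)) (×1-homo-* ℤ.∣ i ∣ ℤ.∣ j ∣) ⟩
    (sign⟦ ℤ.sign i ⟧ * sign⟦ ℤ.sign j ⟧) * (ℤ.∣ i ∣ × 1# * ℤ.∣ j ∣ × 1#)
      ≈⟨ *-interchange _ _ _ _ ⟩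
    (sign⟦ ℤ.sign i ⟧ * ℤ.∣ i ∣ × 1#) * (sign⟦ ℤ.sign j ⟧ * ℤ.∣ j ∣ × 1#)
      ≈⟨ *-cong (◃-homo (ℤ.sign i) ℤ.∣ i ∣) (◃-homo (ℤ.sign j) ℤ.∣ j ∣) ⟨
    ⟦ ℤ.sign i ℤ.◃ ℤ.∣ i ∣ ⟧ * ⟦ ℤ.sign j ℤ.◃ ℤ.∣ j ∣ ⟧
      ≡⟨ ≡.cong₂ (λ a b → ⟦ a ⟧ * ⟦ b ⟧) (ℤₚ.◃-inverse i) (ℤₚ.◃-inverse j) ⟩
    ⟦ i ⟧ * ⟦ j ⟧
      ∎

  -‿homo : ∀ i → ⟦ ℤ.- i ⟧ ≈ - ⟦ i ⟧
  -‿homo -[1+ n ]    = sym (-‿involutive _)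
  -‿homo (ℤ.+ 0)     = sym -0#≈0#
  -‿homo (ℤ.+ suc n) = refl

  homomorphism : ℤ.+-*-rawRing ACR.-Raw-AlmostCommutative⟶ ACR.fromCommutativeRing R
  homomorphism = record
    { ⟦_⟧ = ⟦_⟧ ; +-homo = +-homo ; *-homo = *-homo ; -‿homo = -‿homo
    ; 0-homo = refl ; 1-homo = refl }

  open Algebra.Solver.Ring ℤ.+-*-rawRing (ACR.fromCommutativeRing R) homomorphism
    (λ i j → Maybe.map (reflexive ∘ ≡.cong ⟦_⟧) (dec⇒maybe (i ℤₚ.≟ j)))
    public using (solve; _:=_; _:+_; _:*_; _:-_; :-_; con)

open import Data.Product.Base using (_,_; proj₁; proj₂)
open import Data.Sum.Base using (inj₁; inj₂)
open ≡ using (_≡_; _≢_; _≗_; refl; sym; trans; cong; cong₂; subst; subst₂; module ≡-Reasoning)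

module MatrixTheory (R : RealField) where
  open RealField R
  open Matrices R

  commutativeRing : CommutativeRing 0ℓ 0ℓ
  commutativeRing = record { isCommutativeRing = isCommutativeRing }

  open CommutativeRing commutativeRing
    using (+-comm; +-identityˡ; +-identityʳ; -‿inverseˡ; -‿inverseʳ;
           *-comm; *-assoc; *-identityˡ; zeroˡ; zeroʳ; distribˡ;
           +-commutativeSemigroup; *-commutativeSemigroup)
  open import Algebra.Properties.CommutativeSemigroup +-commutativeSemigroup
    using (interchange)
  open import Algebra.Properties.CommutativeSemigroup *-commutativeSemigroup
    using () renaming (x∙yz≈y∙xz to x*yz≈y*xz; x∙yz≈yx∙z to x*yz≈yx*z;
                       xy∙z≈zy∙x to xy*z≈zy*x)
  open IntegerCoefficientRingSolver commutativeRing

  sumF-cong : ∀ n {f g : Fin n → Carrier} → f ≗ g → sumF n f ≡ sumF n g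
  sumF-cong zero    f≗g = refl
  sumF-cong (suc n) f≗g = cong₂ _+_ (f≗g zero) (sumF-cong n (f≗g ∘ suc))

  sumF-zero : ∀ n {f : Fin n → Carrier} → (∀ i → f i ≡ 0#) → sumF n f ≡ 0#
  sumF-zero zero    f≡0 = refl
  sumF-zero (suc n) f≡0 =
    trans (cong₂ _+_ (f≡0 zero) (sumF-zero n (f≡0 ∘ suc))) (+-identityˡ 0#)

  sumF-+ : ∀ n (f g : Fin n → Carrier) →
    sumF n (λ i → f i + g i) ≡ sumF n f + sumF n g
  sumF-+ zero    f g = sym (+-identityˡ 0#)
  sumF-+ (suc n) f g =
    trans (cong ((f zero + g zero) +_) (sumF-+ n (f ∘ suc) (g ∘ suc))) (interchange _ _ _ _)

  sumF-*ˡ : ∀ n a (f : Fin n → Carrier) → sumF n (λ i → a * f i) ≡ a * sumF n f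
  sumF-*ˡ zero    a f = sym (zeroʳ a)
  sumF-*ˡ (suc n) a f =
    trans (cong (a * f zero +_) (sumF-*ˡ n a (f ∘ suc))) (sym (distribˡ a _ _))

  sumF-*ʳ : ∀ n a (f : Fin n → Carrier) → sumF n (λ i → f i * a) ≡ sumF n f * a
  sumF-*ʳ n a f =
    trans (sumF-cong n (λ i → *-comm (f i) a)) (trans (sumF-*ˡ n a f) (*-comm a _))

  sumF-swap : ∀ m n (f : Fin m → Fin n → Carrier) →
    sumF m (λ i → sumF n (f i)) ≡ sumF n (λ j → sumF m (λ i → f i j))
  sumF-swap zero    n f = sym (sumF-zero n (λ _ → refl))
  sumF-swap (suc m) n f =
    trans (cong (sumF n (f zero) +_) (sumF-swap m n (f ∘ suc))) (sym (sumF-+ n (f zero) _))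

  I-diag : ∀ n (i : Fin n) → I n i i ≡ 1#
  I-diag n i with i ≟ i
  ... | yes _  = refl
  ... | no i≢i = ⊥-elim (i≢i refl)

  I-suc : ∀ n (i j : Fin n) → I (suc n) (suc i) (suc j) ≡ I n i j
  I-suc n i j with i ≟ j
  ... | yes _ = refl
  ... | no _  = refl

  I-sym : ∀ n (i j : Fin n) → I n i j ≡ I n j i
  I-sym n i j with i ≟ j | j ≟ i
  ... | yes _   | yes _   = refl
  ... | no _    | no _    = refl
  ... | yes i≡j | no j≢i  = ⊥-elim (j≢i (sym i≡j))
  ... | no i≢j  | yes j≡i = ⊥-elim (i≢j (sym j≡i))

  sumF-δ : ∀ n (i : Fin n) (f : Fin n → Carrier) → sumF n (λ j → I n i j * f j) ≡ f i
  sumF-δ (suc n) zero    f =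
    trans (cong₂ _+_ (*-identityˡ _) (sumF-zero n (λ j → zeroˡ _))) (+-identityʳ _)
  sumF-δ (suc n) (suc i) f = trans (cong₂ _+_ (zeroˡ _) rest) (+-identityˡ _)
    where
    rest : sumF n (λ j → I (suc n) (suc i) (suc j) * f (suc j)) ≡ f (suc i)
    rest = trans (sumF-cong n (λ j → cong (_* f (suc j)) (I-suc n i j)))
                 (sumF-δ n i (f ∘ suc))

  ≐-refl : ∀ {m k} {X : Matrix m k} → X ≐ X
  ≐-refl i j = refl

  ≐-sym : ∀ {m k} {X Y : Matrix m k} → X ≐ Y → Y ≐ X
  ≐-sym X≐Y i j = sym (X≐Y i j)

  ≐-trans : ∀ {m k} {X Y Z : Matrix m k} → X ≐ Y → Y ≐ Z → X ≐ Z
  ≐-trans X≐Y Y≐Z i j = trans (X≐Y i j) (Y≐Z i j)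

  ≐-setoid : ℕ → ℕ → Setoid 0ℓ 0ℓ
  ≐-setoid m k = record
    { Carrier       = Matrix m k
    ; _≈_           = _≐_
    ; isEquivalence = record { refl = ≐-refl ; sym = ≐-sym ; trans = ≐-trans }
    }

  module ≐-Reasoning {m k : ℕ} = Relation.Binary.Reasoning.Setoid (≐-setoid m k)

  ⊗-cong : ∀ {m k l} {X X′ : Matrix m k} {Y Y′ : Matrix k l} →
    X ≐ X′ → Y ≐ Y′ → (X ⊗ Y) ≐ (X′ ⊗ Y′)
  ⊗-cong {k = k} X≐X′ Y≐Y′ i j = sumF-cong k (λ t → cong₂ _*_ (X≐X′ i t) (Y≐Y′ t j))

  ⊗-assoc : ∀ {m k l p} (X : Matrix m k) (Y : Matrix k l) (Z : Matrix l p) →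
    ((X ⊗ Y) ⊗ Z) ≐ (X ⊗ (Y ⊗ Z))
  ⊗-assoc {k = k} {l} X Y Z i j = begin
    sumF l (λ t → sumF k (λ s → X i s * Y s t) * Z t j)
      ≡⟨ sumF-cong l (λ t → sumF-*ʳ k (Z t j) _) ⟨
    sumF l (λ t → sumF k (λ s → X i s * Y s t * Z t j))
      ≡⟨ sumF-swap l k _ ⟩
    sumF k (λ s → sumF l (λ t → X i s * Y s t * Z t j))
      ≡⟨ sumF-cong k (λ s → trans (sumF-cong l (λ t → *-assoc _ _ _))
                                  (sumF-*ˡ l (X i s) _)) ⟩
    sumF k (λ s → X i s * sumF l (λ t → Y s t * Z t j))
      ∎
    where open ≡-Reasoning

  ᵀ-cong : ∀ {m k} {X Y : Matrix m k} → X ≐ Y → (X ᵀ) ≐ (Y ᵀ)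
  ᵀ-cong X≐Y i j = X≐Y j i

  ᵀ-anti-homo-⊗ : ∀ {m k l} (X : Matrix m k) (Y : Matrix k l) →
    ((X ⊗ Y) ᵀ) ≐ ((Y ᵀ) ⊗ (X ᵀ))
  ᵀ-anti-homo-⊗ {k = k} X Y i j = sumF-cong k (λ t → *-comm (X j t) (Y t i))

  ⊗-identityˡ : ∀ {m k} (X : Matrix m k) → (I m ⊗ X) ≐ X
  ⊗-identityˡ {m} X i j = sumF-δ m i (λ t → X t j)

  ⊗-identityʳ : ∀ {m k} (X : Matrix m k) → (X ⊗ I k) ≐ X
  ⊗-identityʳ {k = k} X i j =
    trans (sumF-cong k (λ t → trans (*-comm _ _) (cong (_* X i t) (I-sym k t j))))
          (sumF-δ k j (X i))

  symmetric-inverseʳ⇒inverseˡ : ∀ {m} {C X : Matrix m m} →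
    (C ᵀ) ≐ C → (C ⊗ X) ≐ I m → (X ⊗ C) ≐ I m
  symmetric-inverseʳ⇒inverseˡ {m} {C} {X} C-sym C⊗X≐I = begin
    X ⊗ C          ≈⟨ ⊗-cong Xᵀ≐X ≐-refl ⟨
    (X ᵀ) ⊗ C      ≈⟨ Xᵀ⊗C≐I ⟩
    I m            ∎
    where
    open ≐-Reasoning
    Xᵀ⊗C≐I : ((X ᵀ) ⊗ C) ≐ I m
    Xᵀ⊗C≐I = begin
      (X ᵀ) ⊗ C          ≈⟨ ⊗-cong ≐-refl C-sym ⟨
      (X ᵀ) ⊗ (C ᵀ)      ≈⟨ ᵀ-anti-homo-⊗ C X ⟨
      (C ⊗ X) ᵀ          ≈⟨ ᵀ-cong C⊗X≐I ⟩
      I m ᵀ              ≈⟨ (λ i j → I-sym m j i) ⟩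
      I m                ∎
    Xᵀ≐X : (X ᵀ) ≐ X
    Xᵀ≐X = begin
      X ᵀ                ≈⟨ ⊗-identityʳ (X ᵀ) ⟨
      (X ᵀ) ⊗ I m        ≈⟨ ⊗-cong ≐-refl C⊗X≐I ⟨
      (X ᵀ) ⊗ (C ⊗ X)    ≈⟨ ⊗-assoc (X ᵀ) C X ⟨
      ((X ᵀ) ⊗ C) ⊗ X    ≈⟨ ⊗-cong Xᵀ⊗C≐I ≐-refl ⟩
      I m ⊗ X            ≈⟨ ⊗-identityˡ X ⟩
      X                  ∎

  Vector : ℕ → Set
  Vector n = Fin n → Carrier

  ⟨_,_⟩ : ∀ {n} → Vector n → Vector n → Carrier
  ⟨_,_⟩ {n} u v = sumF n (λ i → u i * v i)

  _·_ : ∀ {m k} → Matrix m k → Vector k → Vector m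
  (X · v) i = ⟨ X i , v ⟩

  qf : ∀ {n} → Matrix n n → Vector n → Carrier
  qf {n} A x = sumF n (λ i → sumF n (λ j → x i * (A i j * x j)))

  ⟨⟩-congˡ : ∀ {n} {u u′ : Vector n} (v : Vector n) → u ≗ u′ →
    ⟨ u , v ⟩ ≡ ⟨ u′ , v ⟩
  ⟨⟩-congˡ {n} v u≗u′ = sumF-cong n (λ i → cong (_* v i) (u≗u′ i))

  ⟨⟩-congʳ : ∀ {n} (u : Vector n) {v v′ : Vector n} → v ≗ v′ →
    ⟨ u , v ⟩ ≡ ⟨ u , v′ ⟩
  ⟨⟩-congʳ {n} u v≗v′ = sumF-cong n (λ i → cong (u i *_) (v≗v′ i))

  ⟨⟩-comm : ∀ {n} (u v : Vector n) → ⟨ u , v ⟩ ≡ ⟨ v , u ⟩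
  ⟨⟩-comm {n} u v = sumF-cong n (λ i → *-comm (u i) (v i))

  ⟨⟩-*ʳ : ∀ {n} (u : Vector n) a (v : Vector n) →
    ⟨ u , (λ i → a * v i) ⟩ ≡ a * ⟨ u , v ⟩
  ⟨⟩-*ʳ {n} u a v = trans (sumF-cong n (λ i → x*yz≈y*xz (u i) a (v i))) (sumF-*ˡ n a _)

  ⟨⟩-linearʳ : ∀ {n} (u : Vector n) s (v v′ : Vector n) →
    ⟨ u , (λ i → s * v i + v′ i) ⟩ ≡ s * ⟨ u , v ⟩ + ⟨ u , v′ ⟩
  ⟨⟩-linearʳ {n} u s v v′ =
    trans (sumF-cong n (λ i → distribˡ (u i) _ _))
          (trans (sumF-+ n _ _) (cong (_+ ⟨ u , v′ ⟩) (⟨⟩-*ʳ u s v)))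

  ⟨⟩-linearˡ : ∀ {n} s (v v′ u : Vector n) →
    ⟨ (λ i → s * v i + v′ i) , u ⟩ ≡ s * ⟨ v , u ⟩ + ⟨ v′ , u ⟩
  ⟨⟩-linearˡ s v v′ u = trans (⟨⟩-comm _ u)
    (trans (⟨⟩-linearʳ u s v v′)
           (cong₂ (λ a b → s * a + b) (⟨⟩-comm u v) (⟨⟩-comm u v′)))

  ·-congʳ : ∀ {m k} {X Y : Matrix m k} (v : Vector k) → X ≐ Y → (X · v) ≗ (Y · v)
  ·-congʳ v X≐Y i = ⟨⟩-congˡ v (X≐Y i)

  ·-congˡ : ∀ {m k} (X : Matrix m k) {u v : Vector k} → u ≗ v → (X · u) ≗ (X · v)
  ·-congˡ X u≗v i = ⟨⟩-congʳ (X i) u≗v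

  ·-assoc : ∀ {m k l} (X : Matrix m k) (Y : Matrix k l) (v : Vector l) →
    ((X ⊗ Y) · v) ≗ (X · (Y · v))
  ·-assoc X Y v i = ⊗-assoc {p = 1} X Y (λ j _ → v j) i zero

  ·-identityˡ : ∀ {n} (v : Vector n) → (I n · v) ≗ v
  ·-identityˡ {n} v i = sumF-δ n i v

  ·-adjoint : ∀ {m k} (u : Vector m) (X : Matrix m k) (v : Vector k) →
    ⟨ u , X · v ⟩ ≡ ⟨ (X ᵀ) · u , v ⟩
  ·-adjoint {m} {k} u X v = begin
    sumF m (λ i → u i * sumF k (λ j → X i j * v j))
      ≡⟨ sumF-cong m (λ i → sumF-*ˡ k (u i) _) ⟨
    sumF m (λ i → sumF k (λ j → u i * (X i j * v j)))
      ≡⟨ sumF-swap m k _ ⟩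
    sumF k (λ j → sumF m (λ i → u i * (X i j * v j)))
      ≡⟨ sumF-cong k (λ j → trans (sumF-cong m (λ i → x*yz≈yx*z (u i) (X i j) (v j)))
                                  (sumF-*ʳ m (v j) _)) ⟩
    sumF k (λ j → sumF m (λ i → X i j * u i) * v j)
      ∎
    where open ≡-Reasoning

  qf-⟨⟩ : ∀ {n} (A : Matrix n n) (x : Vector n) → qf A x ≡ ⟨ x , A · x ⟩
  qf-⟨⟩ {n} A x = sumF-cong n (λ i → sumF-*ˡ n (x i) _)

  qf-cong : ∀ {n} {A B : Matrix n n} (x : Vector n) → A ≐ B → qf A x ≡ qf B x
  qf-cong {n} x A≐B =
    sumF-cong n (λ i → sumF-cong n (λ j → cong (λ a → x i * (a * x j)) (A≐B i j)))

  qf-sandwich : ∀ {m n} (B : Matrix m n) (C : Matrix m m) (x : Vector n) →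
    qf (((B ᵀ) ⊗ C) ⊗ B) x ≡ qf C (B · x)
  qf-sandwich B C x = begin
    qf (((B ᵀ) ⊗ C) ⊗ B) x            ≡⟨ qf-⟨⟩ (((B ᵀ) ⊗ C) ⊗ B) x ⟩
    ⟨ x , (((B ᵀ) ⊗ C) ⊗ B) · x ⟩     ≡⟨ ⟨⟩-congʳ x (λ i → trans (·-assoc ((B ᵀ) ⊗ C) B x i)
                                                              (·-assoc (B ᵀ) C (B · x) i)) ⟩
    ⟨ x , (B ᵀ) · (C · (B · x)) ⟩     ≡⟨ ·-adjoint x (B ᵀ) (C · (B · x)) ⟩
    ⟨ B · x , C · (B · x) ⟩           ≡⟨ qf-⟨⟩ C (B · x) ⟨
    qf C (B · x)                      ∎
    where open ≡-Reasoning

  qf-expansion : ∀ {n} {A : Matrix n n} → (A ᵀ) ≐ A → ∀ s (w u : Vector n) →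
    qf A (λ i → s * w i + u i) ≡ (s * s) * qf A w + (s + s) * ⟨ u , A · w ⟩ + qf A u
  qf-expansion {A = A} A-sym s w u = begin
    qf A z
      ≡⟨ qf-⟨⟩ A z ⟩
    ⟨ z , A · z ⟩
      ≡⟨ trans (⟨⟩-congʳ z (λ i → ⟨⟩-linearʳ (A i) s w u))
               (⟨⟩-linearʳ z s (A · w) (A · u)) ⟩
    s * ⟨ z , A · w ⟩ + ⟨ z , A · u ⟩
      ≡⟨ cong₂ (λ a c → s * a + c) (⟨⟩-linearˡ s w u (A · w)) (⟨⟩-linearˡ s w u (A · u)) ⟩
    s * (s * ⟨ w , A · w ⟩ + ⟨ u , A · w ⟩) + (s * ⟨ w , A · u ⟩ + ⟨ u , A · u ⟩)
      ≡⟨ cong₂ (λ a c → s * (s * a + b) + (s * c + ⟨ u , A · u ⟩))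
               (sym (qf-⟨⟩ A w)) ⟨w,Au⟩≡⟨u,Aw⟩ ⟩
    s * (s * qf A w + b) + (s * b + ⟨ u , A · u ⟩)
      ≡⟨ cong (λ c → s * (s * qf A w + b) + (s * b + c)) (qf-⟨⟩ A u) ⟨
    s * (s * qf A w + b) + (s * b + qf A u)
      ≡⟨ solve 4 (λ s q b q′ → s :* (s :* q :+ b) :+ (s :* b :+ q′)
                             := s :* s :* q :+ (s :+ s) :* b :+ q′)
               refl s (qf A w) b (qf A u) ⟩
    (s * s) * qf A w + (s + s) * b + qf A u
      ∎
    where
    open ≡-Reasoning
    z : Vector _
    z i = s * w i + u i
    b : Carrier
    b = ⟨ u , A · w ⟩
    ⟨w,Au⟩≡⟨u,Aw⟩ : ⟨ w , A · u ⟩ ≡ b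
    ⟨w,Au⟩≡⟨u,Aw⟩ =
      trans (·-adjoint w A u) (trans (⟨⟩-congˡ u (·-congʳ w A-sym)) (⟨⟩-comm _ u))

  select : ∀ {k n} → (Fin k → Fin n) → Matrix k n
  select {n = n} S t = I n (S t)

  sub≐select-sandwich : ∀ {k n} (B : Matrix n n) (S : Fin k → Fin n) →
    sub B S ≐ ((select S ⊗ B) ⊗ (select S ᵀ))
  sub≐select-sandwich {n = n} B S i j = sym (begin
    sumF n (λ m → (select S ⊗ B) i m * I n (S j) m)
      ≡⟨ sumF-cong n (λ m → cong (_* I n (S j) m) (sumF-δ n (S i) (λ l → B l m))) ⟩
    sumF n (λ m → B (S i) m * I n (S j) m)
      ≡⟨ sumF-cong n (λ m → *-comm _ _) ⟩
    sumF n (λ m → I n (S j) m * B (S i) m)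
      ≡⟨ sumF-δ n (S j) (B (S i)) ⟩
    B (S i) (S j)
      ∎)
    where open ≡-Reasoning

  qf-sub : ∀ {k n} (B : Matrix n n) (S : Fin k → Fin n) (x : Vector k) →
    qf (sub B S) x ≡ qf B ((select S ᵀ) · x)
  qf-sub B S x = trans (qf-cong x (sub≐select-sandwich B S)) (qf-sandwich (select S ᵀ) B x)

  sub-· : ∀ {k n} (B : Matrix n n) (S : Fin k → Fin n) (x : Vector k) →
    (sub B S · x) ≗ (select S · (B · ((select S ᵀ) · x)))
  sub-· B S x i = begin
    (sub B S · x) i                           ≡⟨ ·-congʳ x (sub≐select-sandwich B S) i ⟩
    (((select S ⊗ B) ⊗ (select S ᵀ)) · x) i   ≡⟨ ·-assoc (select S ⊗ B) (select S ᵀ) x i ⟩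
    ((select S ⊗ B) · ((select S ᵀ) · x)) i   ≡⟨ ·-assoc (select S) B ((select S ᵀ) · x) i ⟩
    (select S · (B · ((select S ᵀ) · x))) i   ∎
    where open ≡-Reasoning

  -- The Moore–Penrose inverse of a symmetric matrix

  module SymmetricPseudoinverse {n} {A G : Matrix n n} (A-sym : (A ᵀ) ≐ A)
    (AGA≐A : ((A ⊗ G) ⊗ A) ≐ A) (GAG≐G : ((G ⊗ A) ⊗ G) ≐ G)
    (AG-sym : ((A ⊗ G) ᵀ) ≐ (A ⊗ G)) (GA-sym : ((G ⊗ A) ᵀ) ≐ (G ⊗ A)) where

    open ≐-Reasoning

    A≐A⊗AG : A ≐ (A ⊗ (A ⊗ G))
    A≐A⊗AG = begin
      A                       ≈⟨ A-sym ⟨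
      A ᵀ                     ≈⟨ ᵀ-cong AGA≐A ⟨
      ((A ⊗ G) ⊗ A) ᵀ         ≈⟨ ᵀ-anti-homo-⊗ (A ⊗ G) A ⟩
      (A ᵀ) ⊗ ((A ⊗ G) ᵀ)     ≈⟨ ⊗-cong A-sym AG-sym ⟩
      A ⊗ (A ⊗ G)             ∎

    A≐GA⊗A : A ≐ ((G ⊗ A) ⊗ A)
    A≐GA⊗A = begin
      A                       ≈⟨ A-sym ⟨
      A ᵀ                     ≈⟨ ᵀ-cong AGA≐A ⟨
      ((A ⊗ G) ⊗ A) ᵀ         ≈⟨ ᵀ-cong (⊗-assoc A G A) ⟩
      (A ⊗ (G ⊗ A)) ᵀ         ≈⟨ ᵀ-anti-homo-⊗ A (G ⊗ A) ⟩
      ((G ⊗ A) ᵀ) ⊗ (A ᵀ)     ≈⟨ ⊗-cong GA-sym A-sym ⟩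
      (G ⊗ A) ⊗ A             ∎

    AG≐GA : (A ⊗ G) ≐ (G ⊗ A)
    AG≐GA = begin
      A ⊗ G                   ≈⟨ ⊗-cong A≐GA⊗A ≐-refl ⟩
      ((G ⊗ A) ⊗ A) ⊗ G       ≈⟨ ⊗-assoc (G ⊗ A) A G ⟩
      (G ⊗ A) ⊗ (A ⊗ G)       ≈⟨ ⊗-assoc G A (A ⊗ G) ⟩
      G ⊗ (A ⊗ (A ⊗ G))       ≈⟨ ⊗-cong ≐-refl A≐A⊗AG ⟨
      G ⊗ A                   ∎

    Gᵀ⊗A≐G⊗A : ((G ᵀ) ⊗ A) ≐ (G ⊗ A)
    Gᵀ⊗A≐G⊗A = begin
      (G ᵀ) ⊗ A               ≈⟨ ⊗-cong ≐-refl A-sym ⟨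
      (G ᵀ) ⊗ (A ᵀ)           ≈⟨ ᵀ-anti-homo-⊗ A G ⟨
      (A ⊗ G) ᵀ               ≈⟨ AG-sym ⟩
      A ⊗ G                   ≈⟨ AG≐GA ⟩
      G ⊗ A                   ∎

    G-sym : (G ᵀ) ≐ G
    G-sym = begin
      G ᵀ                     ≈⟨ ᵀ-cong GAG≐G ⟨
      ((G ⊗ A) ⊗ G) ᵀ         ≈⟨ ᵀ-anti-homo-⊗ (G ⊗ A) G ⟩
      (G ᵀ) ⊗ ((G ⊗ A) ᵀ)     ≈⟨ ⊗-cong ≐-refl (≐-trans GA-sym (≐-sym AG≐GA)) ⟩
      (G ᵀ) ⊗ (A ⊗ G)         ≈⟨ ⊗-assoc (G ᵀ) A G ⟨
      ((G ᵀ) ⊗ A) ⊗ G         ≈⟨ ⊗-cong Gᵀ⊗A≐G⊗A ≐-refl ⟩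
      (G ⊗ A) ⊗ G             ≈⟨ GAG≐G ⟩
      G                       ∎

    qf-pinv : ∀ y → qf G y ≡ qf A (G · y)
    qf-pinv y = trans (qf-cong y G≐GᵀAG) (qf-sandwich G A y)
      where
      G≐GᵀAG : G ≐ (((G ᵀ) ⊗ A) ⊗ G)
      G≐GᵀAG = ≐-trans (≐-sym GAG≐G) (⊗-cong (≐-sym Gᵀ⊗A≐G⊗A) ≐-refl)

    A·y≗A·A·G·y : ∀ y → (A · y) ≗ (A · (A · (G · y)))
    A·y≗A·A·G·y y i =
      trans (·-congʳ y A≐A⊗AG i)
            (trans (·-assoc A (A ⊗ G) y i) (·-congˡ A (·-assoc A G y) i))

  +-mono₂-≤ : ∀ {x y u v} → x ≤ y → u ≤ v → x + u ≤ y + v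
  +-mono₂-≤ {x} {y} {u} {v} x≤y u≤v =
    ≤-trans (+-mono-≤ u x≤y) (subst₂ _≤_ (+-comm u y) (+-comm v y) (+-mono-≤ y u≤v))

  x≤0⇒0≤-x : ∀ {x} → x ≤ 0# → 0# ≤ - x
  x≤0⇒0≤-x {x} x≤0 = subst₂ _≤_ (-‿inverseʳ x) (+-identityˡ (- x)) (+-mono-≤ (- x) x≤0)

  0≤-x⇒x≤0 : ∀ {x} → 0# ≤ - x → x ≤ 0#
  0≤-x⇒x≤0 {x} 0≤-x = subst₂ _≤_ (+-identityˡ x) (-‿inverseˡ x) (+-mono-≤ x 0≤-x)

  0≤1 : 0# ≤ 1#
  0≤1 with ≤-total 0# 1#
  ... | inj₁ 0≤1 = 0≤1
  ... | inj₂ 1≤0 =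
    subst (0# ≤_) (solve 0 (:- con 1ℤ :* :- con 1ℤ := con 1ℤ) refl) (*-nonneg 0≤-1 0≤-1)
    where
    0≤-1 : 0# ≤ - 1#
    0≤-1 = x≤0⇒0≤-x 1≤0

  0≤x⇒x+1≰0 : ∀ {x} → 0# ≤ x → ¬ (x + 1# ≤ 0#)
  0≤x⇒x+1≰0 {x} 0≤x x+1≤0 = 0≢1 (≤-antisym 0≤1 1≤0)
    where
    1≤0 : 1# ≤ 0#
    1≤0 = ≤-trans (subst (_≤ x + 1#) (+-identityˡ 1#) (+-mono₂-≤ 0≤x (≤-refl 1#)))
                  x+1≤0

  psd-isotropic⇒kernel : ∀ {n} {A : Matrix n n} → PSD A → ∀ {w} → qf A w ≡ 0# →
    ∀ u → ¬ ¬ (⟨ u , A · w ⟩ ≡ 0#)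
  psd-isotropic⇒kernel {A = A} (A-sym , A-psd) {w} qf[w]≡0 u b≢0 =
    0≤x⇒x+1≰0 0≤q+1
      (0≤-x⇒x≤0 (subst (0# ≤_) qf[sw+u]≡-[q+2] (A-psd (λ i → s * w i + u i))))
    where
    open ≡-Reasoning
    b q b⁻¹ s : Carrier
    b   = ⟨ u , A · w ⟩
    q   = qf A u
    b⁻¹ = proj₁ (inverse b b≢0)
    s   = - ((q + 1#) * b⁻¹)
    0≤q+1 : 0# ≤ q + 1#
    0≤q+1 = subst (_≤ q + 1#) (+-identityˡ 0#) (+-mono₂-≤ (A-psd u) 0≤1)
    -- s is chosen so that the cross term 2sb equals -2(q + 1)
    qf[sw+u]≡-[q+2] : qf A (λ i → s * w i + u i) ≡ - ((q + 1#) + 1#)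
    qf[sw+u]≡-[q+2] = begin
      qf A (λ i → s * w i + u i)
        ≡⟨ qf-expansion A-sym s w u ⟩
      (s * s) * qf A w + (s + s) * b + q
        ≡⟨ cong (λ a → (s * s) * a + (s + s) * b + q) qf[w]≡0 ⟩
      (s * s) * 0# + (s + s) * b + q
        ≡⟨ solve 3 (λ q b b⁻¹ → let s = :- ((q :+ con 1ℤ) :* b⁻¹) in
                      s :* s :* con 0ℤ :+ (s :+ s) :* b :+ q
                      := q :- (q :+ con 1ℤ) :* (b :* b⁻¹) :* con (ℤ.+ 2))
                   refl q b b⁻¹ ⟩
      q + - ((q + 1#) * (b * b⁻¹) * (1# + 1#))
        ≡⟨ cong (λ e → q + - ((q + 1#) * e * (1# + 1#))) (proj₂ (inverse b b≢0)) ⟩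
      q + - ((q + 1#) * 1# * (1# + 1#))
        ≡⟨ solve 1 (λ q → q :- (q :+ con 1ℤ) :* con 1ℤ :* con (ℤ.+ 2)
                          := :- ((q :+ con 1ℤ) :+ con 1ℤ)) refl q ⟩
      - ((q + 1#) + 1#)
        ∎

  -- Schur complements

  -- Equality of reals is not decidable, so an isotropic vector is only known to vanish
  -- up to double negation; that is all that inverting a pivot requires.
  Anisotropic : ∀ {n} → Matrix n n → Set
  Anisotropic {n} C = ∀ x → qf C x ≡ 0# → ∀ i → ¬ ¬ (x i ≡ 0#)

  qf-basis : ∀ {n} (C : Matrix n n) i → qf C (I n i) ≡ C i i
  qf-basis {n} C i = begin
    qf C (I n i)                     ≡⟨ qf-⟨⟩ C (I n i) ⟩
    ⟨ I n i , C · I n i ⟩            ≡⟨ sumF-δ n i (C · I n i) ⟩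
    (C · I n i) i                    ≡⟨ ⟨⟩-comm (C i) (I n i) ⟩
    ⟨ I n i , C i ⟩                  ≡⟨ sumF-δ n i (C i) ⟩
    C i i                            ∎
    where open ≡-Reasoning

  anisotropic⇒diagonal≢0 : ∀ {n} {C : Matrix n n} → Anisotropic C → ∀ i → C i i ≢ 0#
  anisotropic⇒diagonal≢0 {n} {C} C-aniso i Cᵢᵢ≡0 =
    C-aniso (I n i) (trans (qf-basis C i) Cᵢᵢ≡0) i
      (λ Iᵢᵢ≡0 → 0≢1 (trans (sym Iᵢᵢ≡0) (I-diag n i)))

  module SchurComplement {k} (C : Matrix (suc k) (suc k))
    (c⁻¹ : Carrier) (cc⁻¹≡1 : C zero zero * c⁻¹ ≡ 1#) where

    open ≡-Reasoning

    c : Carrier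
    c = C zero zero

    r b : Vector k
    r j = C zero (suc j)
    b i = C (suc i) zero

    D : Matrix k k
    D i j = C (suc i) (suc j)

    schur : Matrix k k
    schur i j = D i j + - ((b i * c⁻¹) * r j)

    schur-sym : (C ᵀ) ≐ C → (schur ᵀ) ≐ schur
    schur-sym C-sym i j = cong₂ (λ d e → d + - e) (C-sym (suc i) (suc j)) (begin
      (b j * c⁻¹) * r i   ≡⟨ cong₂ (λ x y → (x * c⁻¹) * y) (C-sym zero (suc j))
                                                           (C-sym (suc i) zero) ⟩
      (r j * c⁻¹) * b i   ≡⟨ xy*z≈zy*x (r j) c⁻¹ (b i) ⟩
      (b i * c⁻¹) * r j   ∎)

    D·≡schur·+ : ∀ v i → (D · v) i ≡ (schur · v) i + (b i * c⁻¹) * ⟨ r , v ⟩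
    D·≡schur·+ v i = begin
      (D · v) i
        ≡⟨ sumF-cong k (λ j → solve 4 (λ d v β r → d :* v := (d :- β :* r) :* v :+ β :* (r :* v))
                                        refl (D i j) (v j) (b i * c⁻¹) (r j)) ⟩
      sumF k (λ j → schur i j * v j + (b i * c⁻¹) * (r j * v j))
        ≡⟨ trans (sumF-+ k _ _) (cong ((schur · v) i +_) (sumF-*ˡ k (b i * c⁻¹) _)) ⟩
      (schur · v) i + (b i * c⁻¹) * ⟨ r , v ⟩
        ∎

    extend : Vector k → Vector (suc k)
    extend x zero    = - (c⁻¹ * ⟨ r , x ⟩)
    extend x (suc j) = x j

    qf-extend : ∀ x → qf C (extend x) ≡ qf schur x
    qf-extend x = begin
      qf C (extend x)                                 ≡⟨ cong₂ _+_ pivot-row (sumF-cong k other-rows) ⟩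
      0# + ⟨ x , schur · x ⟩                          ≡⟨ +-identityˡ _ ⟩
      ⟨ x , schur · x ⟩                               ≡⟨ qf-⟨⟩ schur x ⟨
      qf schur x                                      ∎
      where
      ρ z₀ : Carrier
      ρ  = ⟨ r , x ⟩
      z₀ = extend x zero
      pivot-row : z₀ * (c * z₀) + sumF k (λ j → z₀ * (r j * x j)) ≡ 0#
      pivot-row = begin
        z₀ * (c * z₀) + sumF k (λ j → z₀ * (r j * x j))
          ≡⟨ cong (z₀ * (c * z₀) +_) (sumF-*ˡ k z₀ _) ⟩
        z₀ * (c * z₀) + z₀ * ρ
          ≡⟨ solve 3 (λ c c⁻¹ ρ → let z₀ = :- (c⁻¹ :* ρ) in
                        z₀ :* (c :* z₀) :+ z₀ :* ρ := c⁻¹ :* ρ :* ρ :* (c :* c⁻¹ :- con 1ℤ))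
                     refl c c⁻¹ ρ ⟩
        c⁻¹ * ρ * ρ * (c * c⁻¹ + - 1#)
          ≡⟨ cong (λ e → c⁻¹ * ρ * ρ * (e + - 1#)) cc⁻¹≡1 ⟩
        c⁻¹ * ρ * ρ * (1# + - 1#)
          ≡⟨ solve 2 (λ c⁻¹ ρ → c⁻¹ :* ρ :* ρ :* (con 1ℤ :- con 1ℤ) := con 0ℤ) refl c⁻¹ ρ ⟩
        0#
          ∎
      other-rows : ∀ i →
        x i * (b i * z₀) + sumF k (λ j → x i * (D i j * x j)) ≡ x i * (schur · x) i
      other-rows i = begin
        x i * (b i * z₀) + sumF k (λ j → x i * (D i j * x j))
          ≡⟨ cong (x i * (b i * z₀) +_)
                  (trans (sumF-*ˡ k (x i) _) (cong (x i *_) (D·≡schur·+ x i))) ⟩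
        x i * (b i * z₀) + x i * ((schur · x) i + (b i * c⁻¹) * ρ)
          ≡⟨ solve 5 (λ x b c⁻¹ ρ σ → x :* (b :* :- (c⁻¹ :* ρ)) :+ x :* (σ :+ b :* c⁻¹ :* ρ)
                                      := x :* σ)
                     refl (x i) (b i) c⁻¹ ρ ((schur · x) i) ⟩
        x i * (schur · x) i
          ∎

    schur-anisotropic : Anisotropic C → Anisotropic schur
    schur-anisotropic C-aniso x qf≡0 i = C-aniso (extend x) (trans (qf-extend x) qf≡0) (suc i)

    blockInverse : Matrix k k → Matrix (suc k) (suc k)
    blockInverse T zero    zero    = c⁻¹ + (c⁻¹ * c⁻¹) * ⟨ r , T · b ⟩
    blockInverse T zero    (suc l) = - (c⁻¹ * ⟨ r , (λ j → T j l) ⟩)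
    blockInverse T (suc i) zero    = - c⁻¹ * (T · b) i
    blockInverse T (suc i) (suc l) = T i l

    module _ {T : Matrix k k} (schur⊗T≐I : (schur ⊗ T) ≐ I k) where

      private
        u : Vector k
        u = T · b

        ρ : Carrier
        ρ = ⟨ r , u ⟩

        schur·u≗b : (schur · u) ≗ b
        schur·u≗b i =
          trans (sym (·-assoc schur T b i)) (trans (·-congʳ b schur⊗T≐I i) (·-identityˡ b i))

      C⊗blockInverse≐I : (C ⊗ blockInverse T) ≐ I (suc k)
      C⊗blockInverse≐I zero zero = begin
        c * (c⁻¹ + (c⁻¹ * c⁻¹) * ρ) + ⟨ r , (λ j → - c⁻¹ * u j) ⟩
          ≡⟨ cong (c * (c⁻¹ + (c⁻¹ * c⁻¹) * ρ) +_) (⟨⟩-*ʳ r (- c⁻¹) u) ⟩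
        c * (c⁻¹ + (c⁻¹ * c⁻¹) * ρ) + - c⁻¹ * ρ
          ≡⟨ solve 3 (λ c c⁻¹ ρ → c :* (c⁻¹ :+ c⁻¹ :* c⁻¹ :* ρ) :+ :- c⁻¹ :* ρ
                                  := c :* c⁻¹ :* (con 1ℤ :+ c⁻¹ :* ρ) :- c⁻¹ :* ρ) refl c c⁻¹ ρ ⟩
        c * c⁻¹ * (1# + c⁻¹ * ρ) + - (c⁻¹ * ρ)
          ≡⟨ cong (λ e → e * (1# + c⁻¹ * ρ) + - (c⁻¹ * ρ)) cc⁻¹≡1 ⟩
        1# * (1# + c⁻¹ * ρ) + - (c⁻¹ * ρ)
          ≡⟨ solve 2 (λ c⁻¹ ρ → con 1ℤ :* (con 1ℤ :+ c⁻¹ :* ρ) :- c⁻¹ :* ρ := con 1ℤ) refl c⁻¹ ρ ⟩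
        1#
          ∎
      C⊗blockInverse≐I zero (suc l) = begin
        c * - (c⁻¹ * t) + t
          ≡⟨ solve 3 (λ c c⁻¹ t → c :* :- (c⁻¹ :* t) :+ t := (con 1ℤ :- c :* c⁻¹) :* t)
                     refl c c⁻¹ t ⟩
        (1# + - (c * c⁻¹)) * t
          ≡⟨ cong (λ e → (1# + - e) * t) cc⁻¹≡1 ⟩
        (1# + - 1#) * t
          ≡⟨ solve 1 (λ t → (con 1ℤ :- con 1ℤ) :* t := con 0ℤ) refl t ⟩
        0#
          ∎
        where
        t : Carrier
        t = ⟨ r , (λ j → T j l) ⟩
      C⊗blockInverse≐I (suc i) zero = begin
        b i * (c⁻¹ + (c⁻¹ * c⁻¹) * ρ) + (D · (λ j → - c⁻¹ * u j)) i
          ≡⟨ cong (b i * (c⁻¹ + (c⁻¹ * c⁻¹) * ρ) +_) (⟨⟩-*ʳ (D i) (- c⁻¹) u) ⟩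
        b i * (c⁻¹ + (c⁻¹ * c⁻¹) * ρ) + - c⁻¹ * (D · u) i
          ≡⟨ cong (λ e → b i * (c⁻¹ + (c⁻¹ * c⁻¹) * ρ) + - c⁻¹ * e)
                  (trans (D·≡schur·+ u i) (cong (_+ (b i * c⁻¹) * ρ) (schur·u≗b i))) ⟩
        b i * (c⁻¹ + (c⁻¹ * c⁻¹) * ρ) + - c⁻¹ * (b i + (b i * c⁻¹) * ρ)
          ≡⟨ solve 3 (λ b c⁻¹ ρ → b :* (c⁻¹ :+ c⁻¹ :* c⁻¹ :* ρ) :+ :- c⁻¹ :* (b :+ b :* c⁻¹ :* ρ)
                                  := con 0ℤ)
                     refl (b i) c⁻¹ ρ ⟩
        0#
          ∎
      C⊗blockInverse≐I (suc i) (suc l) = begin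
        b i * - (c⁻¹ * t) + (D · (λ j → T j l)) i
          ≡⟨ cong (b i * - (c⁻¹ * t) +_) (D·≡schur·+ (λ j → T j l) i) ⟩
        b i * - (c⁻¹ * t) + ((schur ⊗ T) i l + (b i * c⁻¹) * t)
          ≡⟨ solve 4 (λ b c⁻¹ t e → b :* :- (c⁻¹ :* t) :+ (e :+ b :* c⁻¹ :* t) := e)
                     refl (b i) c⁻¹ t ((schur ⊗ T) i l) ⟩
        (schur ⊗ T) i l            ≡⟨ schur⊗T≐I i l ⟩
        I k i l                    ≡⟨ I-suc k i l ⟨
        I (suc k) (suc i) (suc l)  ∎
        where
        t : Carrier
        t = ⟨ r , (λ j → T j l) ⟩

  symmetric-anisotropic⇒nonsingular : ∀ {k} {C : Matrix k k} →
    (C ᵀ) ≐ C → Anisotropic C → Nonsingular C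
  symmetric-anisotropic⇒nonsingular {zero}  _ _ = (λ ()) , (λ ()) , (λ ())
  symmetric-anisotropic⇒nonsingular {suc k} {C} C-sym C-aniso
    with inverse (C zero zero) (anisotropic⇒diagonal≢0 {C = C} C-aniso zero)
  ... | c⁻¹ , cc⁻¹≡1 =
    blockInverse T , C⊗C⁻¹≐I , symmetric-inverseʳ⇒inverseˡ {X = blockInverse T} C-sym C⊗C⁻¹≐I
    where
    open SchurComplement C c⁻¹ cc⁻¹≡1
    schur⁻¹ : Nonsingular schur
    schur⁻¹ = symmetric-anisotropic⇒nonsingular (schur-sym C-sym) (schur-anisotropic C-aniso)
    T : Matrix k k
    T = proj₁ schur⁻¹
    C⊗C⁻¹≐I : (C ⊗ blockInverse T) ≐ I (suc k)
    C⊗C⁻¹≐I = C⊗blockInverse≐I (proj₁ (proj₂ schur⁻¹))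

lemma2p1 : (R : RealField) → let open Matrices R in
    (n : ℕ) (A : Matrix n n) (A† : Matrix n n) →
    PSD A → IsMoorePenrose A A† →
    (k : ℕ) (S : Fin k → Fin n) → StrictlyIncreasing S →
    Nonsingular (sub A S) → Nonsingular (sub A† S)
-- The argument works for any index map S.
lemma2p1 R n A A† A-psd@(A-sym , _) (AA†A≐A , A†AA†≐A† , AA†-sym , A†A-sym) k S _
         (N , _ , N⊗A[S,S]≐I) =
  symmetric-anisotropic⇒nonsingular (λ i j → A†-sym (S i) (S j)) A†[S,S]-anisotropic
  where
  open RealField R
  open Matrices R
  open MatrixTheory R
  open SymmetricPseudoinverse A-sym AA†A≐A A†AA†≐A† AA†-sym A†A-sym
    renaming (G-sym to A†-sym)

  A†[S,S]-anisotropic : Anisotropic (sub A† S)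
  A†[S,S]-anisotropic x qf≡0 i xᵢ≢0 =
    psd-isotropic⇒kernel A-psd qf[w]≡0 (M i) (xᵢ≢0 ∘ trans (x≗M·Aw i))
    where
    open ≡-Reasoning
    y w : Vector n
    y = (select S ᵀ) · x
    w = A† · y
    qf[w]≡0 : qf A w ≡ 0#
    qf[w]≡0 = trans (sym (qf-pinv y)) (trans (sym (qf-sub A† S x)) qf≡0)
    M : Matrix k n
    M = N ⊗ (select S ⊗ A)
    x≗M·Aw : x ≗ (M · (A · w))
    x≗M·Aw j = begin
      x j                                  ≡⟨ ·-identityˡ x j ⟨
      (I k · x) j                          ≡⟨ ·-congʳ x N⊗A[S,S]≐I j ⟨
      ((N ⊗ sub A S) · x) j                ≡⟨ ·-assoc N (sub A S) x j ⟩
      (N · (sub A S · x)) j                ≡⟨ ·-congˡ N (sub-· A S x) j ⟩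
      (N · (select S · (A · y))) j         ≡⟨ ·-congˡ N (·-congˡ (select S) (A·y≗A·A·G·y y)) j ⟩
      (N · (select S · (A · (A · w)))) j   ≡⟨ ·-congˡ N (·-assoc (select S) A (A · w)) j ⟨
      (N · ((select S ⊗ A) · (A · w))) j   ≡⟨ ·-assoc N (select S ⊗ A) (A · w) j ⟨
      (M · (A · w)) j                      ∎
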